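{- Let $G$ be a triangulation of the plane or of the projective plane, and let $L$ be a $3$-list-assignment for $G$. Suppose $u$ is a vertex of degree $4$ in $G$ whose neighbors, in the cyclic order around $u$ given by the embedding, are $u_1,u_2,u_3,u_4$, and suppose $\deg_G(u_1)\le 6$, $\deg_G(u_2)\le 7$ and $\deg_G(u_3)\le 6$. Then every arboreal $L$-coloring of $G-\{u,u_1,u_2,u_3\}$ can be extended to an arboreal $L$-coloring of $G$ in at least two ways.
   Context: A $3$-list-assignment $L$ for $G$ assigns to each vertex $v$ a set $L(v)$ of exactly $3$ colors. An arboreal $L$-coloring of a graph $H$ is a function $f$ with $f(v)\in L(v)$ for all $v\in V(H)$ such that each color class induces a forest in $H$. A triangulation is a simple graph embedded in the surface so that every face is bounded by a triangle. -}

module Defs where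

open import Data.Nat using (ℕ; zero; suc; _+_; _≤_)
open import Data.Bool using (Bool; true; false; _∧_; _∨_; if_then_else_)
open import Data.Fin using (Fin; zero; suc; _≟_)
open import Data.Product using (Σ; _×_; _,_; proj₁; proj₂)
open import Data.Sum using (_⊎_)
open import Data.List using (List; length; _++_; take)
open import Data.List.Relation.Unary.All using (All)
open import Data.List.Relation.Unary.Unique.Propositional using (Unique)
open import Data.List.Relation.Unary.Linked using (Linked)
open import Relation.Binary.PropositionalEquality using (_≡_; _≢_)
open import Relation.Binary.Construct.Closure.ReflexiveTransitive using (Star)
open import Relation.Nullary using (¬_)
open import Relation.Nullary.Decidable using (⌊_⌋)
open import Function.Definitions using (Injective)

countTrue : ∀ {m} → (Fin m → Bool) → ℕ
countTrue {zero}  p = 0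
countTrue {suc m} p = (if p zero then 1 else 0) + countTrue (λ i → p (suc i))

sumFin : ∀ {m} → (Fin m → ℕ) → ℕ
sumFin {zero}  g = 0
sumFin {suc m} g = g zero + sumFin (λ i → g (suc i))

Tri : ℕ → Set
Tri n = Fin n × Fin n × Fin n

corner₁ corner₂ corner₃ : ∀ {n} → Tri n → Fin n
corner₁ t = proj₁ t
corner₂ t = proj₁ (proj₂ t)
corner₃ t = proj₂ (proj₂ t)

inTri : ∀ {n} → Fin n → Tri n → Bool
inTri v t = ⌊ v ≟ corner₁ t ⌋ ∨ (⌊ v ≟ corner₂ t ⌋ ∨ ⌊ v ≟ corner₃ t ⌋)

-- A triangulation of a closed surface of Euler characteristic 2 (sphere)
-- or 1 (projective plane), described combinatorially.
--
-- The faces are an indexed family of triangles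
-- of G (so two faces may in principle have the same vertex set).  The
-- surface conditions are:
--  * every edge of G lies in exactly two faces;
--  * the link of every vertex is connected (it is 2-regular by the
--    previous condition, hence a single cycle: the surface is closed);
--  * G is connected;
--  * Euler's formula  n - e + m = χ  with χ ∈ {2, 1}, written as
--    2n + 2m = (sum of degrees) + 2χ.
-- By the classification of closed surfaces these are exactly the
-- triangulations of the sphere (= plane) and of the projective plane.

record Triangulation (n : ℕ) : Set where
  field
    adj        : Fin n → Fin n → Bool
    adj-sym    : ∀ u v → adj u v ≡ adj v u
    adj-irrefl : ∀ v → adj v v ≡ false
    nFaces     : ℕ
    face       : Fin nFaces → Tri n
    face-tri   : ∀ f → adj (corner₁ (face f)) (corner₂ (face f)) ≡ true
                     × adj (corner₂ (face f)) (corner₃ (face f)) ≡ true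
                     × adj (corner₁ (face f)) (corner₃ (face f)) ≡ true

  Adj : Fin n → Fin n → Set
  Adj u v = adj u v ≡ true

  deg : Fin n → ℕ
  deg v = countTrue (adj v)

  HasFace : Fin n → Fin n → Fin n → Set
  HasFace a b c = Σ (Fin nFaces) λ f →
    inTri a (face f) ≡ true × inTri b (face f) ≡ true × inTri c (face f) ≡ true

  LinkEdge : Fin n → Fin n → Fin n → Set
  LinkEdge v x y = HasFace v x y

  field
    edge-in-two-faces : ∀ u v → Adj u v →
      countTrue (λ f → inTri u (face f) ∧ inTri v (face f)) ≡ 2
    link-connected : ∀ v x y → Adj v x → Adj v y → Star (LinkEdge v) x y
    connected      : ∀ u v → Star Adj u v
    euler          : (n + n + nFaces + nFaces ≡ sumFin deg + 4)
                   ⊎ (n + n + nFaces + nFaces ≡ sumFin deg + 2)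

module _ {n : ℕ} (G : Triangulation n) where
  open Triangulation G

  record CycleIn (X : Fin n → Set) : Set where
    field
      verts  : List (Fin n)
      long   : 3 ≤ length verts
      uniq   : Unique verts
      inX    : All X verts
      closed : Linked Adj (verts ++ take 1 verts)

  InducesForest : (Fin n → Set) → Set
  InducesForest X = ¬ CycleIn X

  record ListAssignment3 : Set where
    field
      colours  : Fin n → Fin 3 → ℕ
      distinct : ∀ v → Injective _≡_ _≡_ (colours v)

  _∈L_at_ : ℕ → ListAssignment3 → Fin n → Set
  c ∈L L at v = Σ (Fin 3) λ i → ListAssignment3.colours L v i ≡ c

  -- an arboreal L-colouring of G - S  (S = set of deleted vertices);
  -- values of col on S are irrelevant.
  record ArborealColouringMinus (L : ListAssignment3) (S : Fin n → Set)
         (col : Fin n → ℕ) : Set where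
    field
      in-list : ∀ v → ¬ S v → col v ∈L L at v
      forest  : ∀ c → InducesForest (λ v → ¬ S v × col v ≡ c)

  NoVertex : Fin n → Set
  NoVertex _ = Fin 0

  ArborealColouring : ListAssignment3 → (Fin n → ℕ) → Set
  ArborealColouring L col = ArborealColouringMinus L NoVertex col

  Extends : (Fin n → Set) → (Fin n → ℕ) → (Fin n → ℕ) → Set
  Extends S col col' = ∀ v → ¬ S v → col' v ≡ col v

{-# OPTIONS --safe #-}
module Submission where

-- Colour the deleted vertices one at a time. A colour c is usable at w when at most one
-- coloured neighbour of w has colour c; then no monochromatic cycle can pass through w.
-- A vertex with at most five coloured neighbours has a usable colour, and one with at most
-- four has two, unless two of its colours are each blocked by two neighbours, in which case
-- all its coloured neighbours carry these two colours and its third colour is free.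
-- If u₁ (or symmetrically u₃) has two usable colours, colour it first and then u₂, the other
-- side vertex and u greedily. Otherwise u₁ and u₃ have free colours r₁ and r₃; colour u₁, u₂,
-- u₃ with r₁, some usable f₂, r₃. If u now has two usable colours we are done. If not, its
-- four neighbours show only two colours, and since the colour of u₄ differs from r₁ and r₃
-- this forces r₁ = r₃ ≠ f₂ with r₁ in the list of u; colouring u₂, u₃, then u with r₁ and
-- finally u₁ with r₁ gives a second extension that differs at u.

open import Defs
open import Data.Bool using (Bool; true; false)
import Data.Bool.Properties as Bool
open import Data.Empty using (⊥; ⊥-elim)
open import Data.Fin using (Fin; zero; suc)
open import Data.Fin.Properties using (_≟_; any?)
open import Data.List using (List; []; _∷_; _++_; [_]; take; length)
open import Data.List.Properties using (++-assoc; ++-identityʳ; length-++)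
open import Data.List.Membership.Propositional using (_∈_; _∉_)
open import Data.List.Membership.Propositional.Properties using (∈-∃++; ∈-++⁻)
open import Data.List.Relation.Binary.Permutation.Propositional using (_↭_; ↭-sym; ↭⇒↭ₛ)
open import Data.List.Relation.Binary.Permutation.Propositional.Properties using (++-comm; ↭-length; ∈-resp-↭)
import Data.List.Relation.Binary.Permutation.Setoid.Properties as PermutationSetoid
open import Data.List.Relation.Unary.All as All using (All; []; _∷_)
open import Data.List.Relation.Unary.All.Properties using (¬Any⇒All¬; All¬⇒¬Any)
import Data.List.Relation.Unary.All.Properties as All
open import Data.List.Relation.Unary.AllPairs using ([]; _∷_)
open import Data.List.Relation.Unary.Any using (here; there)
open import Data.List.Relation.Unary.Linked as Linked using (Linked; []; [-]; _∷_)
open import Data.List.Relation.Unary.Unique.Propositional using (Unique)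
import Data.List.Relation.Unary.Unique.Propositional.Properties as Unique
open import Data.Nat as ℕ using (ℕ; zero; suc; _+_; _≤_; z≤n; s≤s)
open import Data.Nat.Properties using (≤-trans; ≤-reflexive; n≤1+n; +-cancelˡ-≤; 1+n≰n; n≮n)
open import Data.Product using (Σ; ∃; ∃₂; _×_; _,_; proj₁; proj₂)
open import Data.Sum using (_⊎_; inj₁; inj₂)
open import Data.Vec.Functional using (updateAt)
open import Data.Vec.Functional.Properties using (updateAt-updates; updateAt-minimal)
open import Function using (_∘_; const)
open import Relation.Binary.PropositionalEquality
  using (_≡_; _≢_; refl; sym; trans; cong; subst; setoid; ≢-sym; module ≡-Reasoning)
open import Relation.Nullary using (¬_; Dec; yes; no)
open import Relation.Nullary.Decidable using (_×-dec_; ¬?)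

dropZero : ∀ {m} → List (Fin (suc m)) → List (Fin m)
dropZero [] = []
dropZero (zero ∷ xs) = dropZero xs
dropZero (suc i ∷ xs) = i ∷ dropZero xs

∈-dropZero⇒suc∈ : ∀ {m} {i : Fin m} xs → i ∈ dropZero xs → suc i ∈ xs
∈-dropZero⇒suc∈ (zero ∷ xs) i∈ = there (∈-dropZero⇒suc∈ xs i∈)
∈-dropZero⇒suc∈ (suc j ∷ xs) (here refl) = here refl
∈-dropZero⇒suc∈ (suc j ∷ xs) (there i∈) = there (∈-dropZero⇒suc∈ xs i∈)

dropZero-Unique : ∀ {m} {xs : List (Fin (suc m))} → Unique xs → Unique (dropZero xs)
dropZero-Unique {xs = []} [] = []
dropZero-Unique {xs = zero ∷ xs} (_ ∷ u) = dropZero-Unique u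
dropZero-Unique {xs = suc j ∷ xs} (j∉ ∷ u) =
  All.tabulate (λ i∈ j≡i → All.lookup j∉ (∈-dropZero⇒suc∈ xs i∈) (cong suc j≡i)) ∷ dropZero-Unique u

dropZero-All : ∀ {m} {P : Fin (suc m) → Set} {xs} → All P xs → All (P ∘ suc) (dropZero xs)
dropZero-All {xs = []} [] = []
dropZero-All {xs = zero ∷ xs} (_ ∷ ps) = dropZero-All ps
dropZero-All {xs = suc j ∷ xs} (p ∷ ps) = p ∷ dropZero-All ps

length-dropZero-∉ : ∀ {m} {xs : List (Fin (suc m))} → zero ∉ xs → length xs ≤ length (dropZero xs)
length-dropZero-∉ {xs = []} _ = z≤n
length-dropZero-∉ {xs = zero ∷ xs} 0∉ = ⊥-elim (0∉ (here refl))
length-dropZero-∉ {xs = suc j ∷ xs} 0∉ = s≤s (length-dropZero-∉ (0∉ ∘ there))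

length-dropZero : ∀ {m} {xs : List (Fin (suc m))} → Unique xs → length xs ≤ suc (length (dropZero xs))
length-dropZero {xs = []} _ = z≤n
length-dropZero {xs = zero ∷ xs} (0∉ ∷ _) = s≤s (length-dropZero-∉ (All¬⇒¬Any 0∉))
length-dropZero {xs = suc j ∷ xs} (_ ∷ u) = s≤s (length-dropZero u)

length≤countTrue : ∀ {m} (p : Fin m → Bool) {xs} → Unique xs → All (λ i → p i ≡ true) xs →
                   length xs ≤ countTrue p
length≤countTrue {zero} p {[]} _ _ = z≤n
length≤countTrue {suc m} p {xs} u ps with p zero in p0
... | true  = ≤-trans (length-dropZero u) (s≤s (length≤countTrue (p ∘ suc) (dropZero-Unique u) (dropZero-All ps)))
... | false = ≤-trans (length-dropZero-∉ 0∉) (length≤countTrue (p ∘ suc) (dropZero-Unique u) (dropZero-All ps))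
  where
  0∉ : zero ∉ xs
  0∉ 0∈ with () ← trans (sym p0) (All.lookup ps 0∈)

module _ {A : Set} {R : A → A → Set} where

  Linked-split : ∀ xs {w ys} → Linked R (xs ++ w ∷ ys) → Linked R (xs ++ [ w ]) × Linked R (w ∷ ys)
  Linked-split [] l = [-] , l
  Linked-split (x ∷ []) (r ∷ l) = r ∷ [-] , l
  Linked-split (x ∷ x′ ∷ xs) (r ∷ l) with Linked-split (x′ ∷ xs) l
  ... | l₁ , l₂ = r ∷ l₁ , l₂

  Linked-join : ∀ xs {w ys} → Linked R (xs ++ [ w ]) → Linked R (w ∷ ys) → Linked R (xs ++ w ∷ ys)
  Linked-join [] _ l = l
  Linked-join (x ∷ []) (r ∷ [-]) l = r ∷ l
  Linked-join (x ∷ x′ ∷ xs) (r ∷ l₁) l₂ = r ∷ Linked-join (x′ ∷ xs) l₁ l₂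

  Linked-last : ∀ x xs {w} → Linked R (x ∷ xs ++ [ w ]) → ∃ λ z → z ∈ x ∷ xs × R z w
  Linked-last x [] (r ∷ [-]) = x , here refl , r
  Linked-last x (x′ ∷ xs) (_ ∷ l) with Linked-last x′ xs l
  ... | z , z∈ , r = z , there z∈ , r

  Linked-rotate : ∀ ps {w qs} → Linked R ((ps ++ w ∷ qs) ++ take 1 (ps ++ w ∷ qs)) →
                  Linked R (w ∷ (qs ++ ps) ++ [ w ])
  Linked-rotate [] {w} {qs} l rewrite ++-identityʳ qs = l
  Linked-rotate (p ∷ ps) {w} {qs} l rewrite ++-assoc ps (w ∷ qs) [ p ]
    with Linked-split (p ∷ ps) l
  ... | l₁ , l₂ rewrite ++-assoc qs (p ∷ ps) [ w ] = Linked-join (w ∷ qs) l₂ l₁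

  Unique-resp-↭ : ∀ {xs ys : List A} → xs ↭ ys → Unique xs → Unique ys
  Unique-resp-↭ p = PermutationSetoid.Unique-resp-↭ (setoid A) (↭⇒↭ₛ p)

  cycle-neighbours : ∀ {xs w} → 3 ≤ length xs → Unique xs → Linked R (xs ++ take 1 xs) → w ∈ xs →
    ∃₂ λ a z → a ∈ xs × z ∈ xs × a ≢ z × R w a × R z w
  cycle-neighbours {w = w} len u l w∈ with ∈-∃++ w∈
  ... | ps , qs , refl =
    around (qs ++ ps) (↭-sym π) (subst (3 ≤_) (↭-length π) len) (Unique-resp-↭ π u) (Linked-rotate ps l)
    where
    π : ps ++ w ∷ qs ↭ w ∷ qs ++ ps
    π = ++-comm ps (w ∷ qs)
    around : ∀ rs → w ∷ rs ↭ ps ++ w ∷ qs → 3 ≤ suc (length rs) → Unique (w ∷ rs) →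
             Linked R (w ∷ rs ++ [ w ]) → ∃₂ λ a z → a ∈ ps ++ w ∷ qs × z ∈ ps ++ w ∷ qs × a ≢ z × R w a × R z w
    around [] _ (s≤s ()) _ _
    around (_ ∷ []) _ (s≤s (s≤s ())) _ _
    around (a ∷ b ∷ rs) σ _ (_ ∷ a∉ ∷ _) (r ∷ l′) with Linked-last b rs (Linked.tail l′)
    ... | z , z∈ , r′ = a , z , ∈-resp-↭ σ (there (here refl)) , ∈-resp-↭ σ (there (there z∈)) ,
                        (λ { refl → All.lookup a∉ z∈ refl }) , r , r′

≡-of-two-values : ∀ {A : Set} {a b x y z : A} → x ≡ a ⊎ x ≡ b → y ≡ a ⊎ y ≡ b → z ≡ a ⊎ z ≡ b →
                  z ≢ x → z ≢ y → x ≡ y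
≡-of-two-values (inj₁ x≡a) (inj₁ y≡a) _ _ _ = trans x≡a (sym y≡a)
≡-of-two-values (inj₂ x≡b) (inj₂ y≡b) _ _ _ = trans x≡b (sym y≡b)
≡-of-two-values (inj₁ x≡a) (inj₂ _) (inj₁ z≡a) z≢x _ = ⊥-elim (z≢x (trans z≡a (sym x≡a)))
≡-of-two-values (inj₁ _) (inj₂ y≡b) (inj₂ z≡b) _ z≢y = ⊥-elim (z≢y (trans z≡b (sym y≡b)))
≡-of-two-values (inj₂ x≡b) (inj₁ _) (inj₂ z≡b) z≢x _ = ⊥-elim (z≢x (trans z≡b (sym x≡b)))
≡-of-two-values (inj₂ _) (inj₁ y≡a) (inj₁ z≡a) _ z≢y = ⊥-elim (z≢y (trans z≡a (sym y≡a)))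

module ArborealExtension {n : ℕ} (G : Triangulation n) (L : ListAssignment3 G) where
  open Triangulation G
  open ListAssignment3 L
  open import Data.List.Membership.DecPropositional (_≟_ {n}) using (_∈?_)
  open import Data.List.Relation.Unary.Unique.DecPropositional (_≟_ {n}) using (unique?)

  Adj-sym : ∀ {x y} → Adj x y → Adj y x
  Adj-sym {x} {y} x~y = trans (adj-sym y x) x~y

  Adj⇒≢ : ∀ {x y} → Adj x y → x ≢ y
  Adj⇒≢ {x} x~x refl with () ← trans (sym x~x) (adj-irrefl x)

  inTri⇒corner : ∀ (v : Fin n) (t : Tri n) → inTri v t ≡ true → v ≡ corner₁ t ⊎ v ≡ corner₂ t ⊎ v ≡ corner₃ t
  inTri⇒corner v t v∈t with v ≟ corner₁ t | v ≟ corner₂ t | v ≟ corner₃ t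
  ... | yes e | _     | _     = inj₁ e
  ... | no _  | yes e | _     = inj₂ (inj₁ e)
  ... | no _  | no _  | yes e = inj₂ (inj₂ e)
  inTri⇒corner v t () | no _ | no _ | no _

  face-corners-Adj : ∀ f x y → x ≢ y → inTri x (face f) ≡ true → inTri y (face f) ≡ true → Adj x y
  face-corners-Adj f x y x≢y x∈f y∈f
    with face-tri f | inTri⇒corner x (face f) x∈f | inTri⇒corner y (face f) y∈f
  ... | _ , _ , _     | inj₁ refl        | inj₁ refl        = ⊥-elim (x≢y refl)
  ... | a₁₂ , _ , _   | inj₁ refl        | inj₂ (inj₁ refl) = a₁₂
  ... | _ , _ , a₁₃   | inj₁ refl        | inj₂ (inj₂ refl) = a₁₃
  ... | a₁₂ , _ , _   | inj₂ (inj₁ refl) | inj₁ refl        = Adj-sym a₁₂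
  ... | _ , _ , _     | inj₂ (inj₁ refl) | inj₂ (inj₁ refl) = ⊥-elim (x≢y refl)
  ... | _ , a₂₃ , _   | inj₂ (inj₁ refl) | inj₂ (inj₂ refl) = a₂₃
  ... | _ , _ , a₁₃   | inj₂ (inj₂ refl) | inj₁ refl        = Adj-sym a₁₃
  ... | _ , a₂₃ , _   | inj₂ (inj₂ refl) | inj₂ (inj₁ refl) = Adj-sym a₂₃
  ... | _ , _ , _     | inj₂ (inj₂ refl) | inj₂ (inj₂ refl) = ⊥-elim (x≢y refl)

  HasFace⇒Adj : ∀ a {b c} → HasFace a b c → b ≢ c → Adj b c
  HasFace⇒Adj _ (f , _ , b∈f , c∈f) b≢c = face-corners-Adj f _ _ b≢c b∈f c∈f

  length≤deg : ∀ {w ns} → Unique ns → All (Adj w) ns → length ns ≤ deg w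
  length≤deg {w} = length≤countTrue (adj w)

  deg≤length⇒∈ : ∀ {w ns z} → Unique ns → All (Adj w) ns → deg w ≤ length ns → Adj w z → z ∈ ns
  deg≤length⇒∈ {ns = ns} {z} u a d w~z with z ∈? ns
  ... | yes z∈ = z∈
  ... | no z∉ = ⊥-elim (1+n≰n (≤-trans (length≤deg (¬Any⇒All¬ ns z∉ ∷ u) (w~z ∷ a)) d))

  CycleIn-All : ∀ {X Y} (C : CycleIn G X) → All Y (CycleIn.verts C) → CycleIn G Y
  CycleIn-All C Ys = record { verts = verts ; long = long ; uniq = uniq ; inX = Ys ; closed = closed }
    where open CycleIn C

  ArborealColouringMinus-mono : ∀ {S S′ h} → (∀ {v} → S v → S′ v) →
    ArborealColouringMinus G L S h → ArborealColouringMinus G L S′ h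
  ArborealColouringMinus-mono S⊆S′ A = record
    { in-list = λ v v∉S′ → in-list v (v∉S′ ∘ S⊆S′)
    ; forest  = λ c C → forest c (CycleIn-All C (All.map (λ (v∉S′ , e) → v∉S′ ∘ S⊆S′ , e) (CycleIn.inX C)))
    }
    where open ArborealColouringMinus A

  -- ws lists the vertices not yet coloured; the values of h on ws are irrelevant.
  ArborealMinus : List (Fin n) → (Fin n → ℕ) → Set
  ArborealMinus ws = ArborealColouringMinus G L (_∈ ws)

  _[_]≔_ : (Fin n → ℕ) → Fin n → ℕ → Fin n → ℕ
  h [ w ]≔ c = updateAt h w (const c)

  ≔-updates : ∀ {h w c} → (h [ w ]≔ c) w ≡ c
  ≔-updates {h} {w} = updateAt-updates w h

  ≔-minimal : ∀ {h w c v} → v ≢ w → (h [ w ]≔ c) v ≡ h v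
  ≔-minimal {h} {w} {v = v} = updateAt-minimal v w h

  Usable : List (Fin n) → (Fin n → ℕ) → Fin n → ℕ → Set
  Usable ws h w c = ∀ {x y} → Adj w x → Adj w y → x ∉ ws → y ∉ ws → h x ≡ c → h y ≡ c → x ≡ y

  Usable-if-only : ∀ {ws h w c} x → (∀ {z} → Adj w z → z ∉ ws → h z ≡ c → z ≡ x) → Usable ws h w c
  Usable-if-only x only w~y w~z y∉ z∉ hy hz = trans (only w~y y∉ hy) (sym (only w~z z∉ hz))

  Usable-if-uncoloured : ∀ {ws h w c} → (∀ {z} → Adj w z → h z ≡ c → z ∈ ws) → Usable ws h w c
  Usable-if-uncoloured {w = w} unc = Usable-if-only w (λ w~z z∉ e → ⊥-elim (z∉ (unc w~z e)))

  Usable-mono : ∀ {ws ws′ h h′ w c} → (∀ {v} → v ∈ ws → v ∈ ws′) → (∀ {v} → v ∉ ws′ → h′ v ≡ h v) →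
                Usable ws h w c → Usable ws′ h′ w c
  Usable-mono ws⊆ws′ h′≗h ok w~x w~y x∉ y∉ hx hy =
    ok w~x w~y (x∉ ∘ ws⊆ws′) (y∉ ∘ ws⊆ws′) (trans (sym (h′≗h x∉)) hx) (trans (sym (h′≗h y∉)) hy)

  -- A monochromatic cycle through w would give w two distinct neighbours of its colour.
  colour : ∀ {w ws h} → ArborealMinus (w ∷ ws) h → (i : Fin 3) → Usable ws h w (colours w i) →
           ArborealMinus ws (h [ w ]≔ colours w i)
  colour {w} {ws} {h} A i ok = record { in-list = in-list′ ; forest = forest′ }
    where
    open ArborealColouringMinus A
    c : ℕ
    c = colours w i

    h′ : Fin n → ℕ
    h′ = h [ w ]≔ c

    in-list′ : ∀ v → v ∉ ws → _∈L_at_ G (h′ v) L v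
    in-list′ v v∉ with v ≟ w
    ... | yes refl = i , sym ≔-updates
    ... | no v≢w = subst (λ k → _∈L_at_ G k L v) (sym (≔-minimal v≢w))
                         (in-list v λ { (here e) → v≢w e ; (there v∈) → v∉ v∈ })

    not-through-w : ∀ k (C : CycleIn G (λ v → v ∉ ws × h′ v ≡ k)) → w ∉ CycleIn.verts C
    not-through-w k C w∈ with cycle-neighbours long uniq closed w∈
      where open CycleIn C
    ... | a , z , a∈ , z∈ , a≢z , w~a , z~w =
      a≢z (ok w~a (Adj-sym z~w) (proj₁ (All.lookup inX a∈)) (proj₁ (All.lookup inX z∈))
              (coloured-c a∈ (≢-sym (Adj⇒≢ w~a))) (coloured-c z∈ (Adj⇒≢ z~w)))
      where
      open CycleIn C
      open ≡-Reasoning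
      coloured-c : ∀ {v} → v ∈ verts → v ≢ w → h v ≡ c
      coloured-c {v} v∈ v≢w = begin
        h v   ≡⟨ ≔-minimal v≢w ⟨
        h′ v  ≡⟨ proj₂ (All.lookup inX v∈) ⟩
        k     ≡⟨ proj₂ (All.lookup inX w∈) ⟨
        h′ w  ≡⟨ ≔-updates ⟩
        c     ∎

    avoiding-w : ∀ k (C : CycleIn G (λ v → v ∉ ws × h′ v ≡ k)) → w ∉ CycleIn.verts C →
          ∀ {v} → v ∈ CycleIn.verts C → v ∉ w ∷ ws × h v ≡ k
    avoiding-w k C w∉ {v} v∈ with All.lookup (CycleIn.inX C) v∈
    ... | v∉ , e = (λ { (here refl) → w∉ v∈ ; (there v∈ws) → v∉ v∈ws })
                 , trans (sym (≔-minimal λ { refl → w∉ v∈ })) e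

    forest′ : ∀ k → InducesForest G (λ v → v ∉ ws × h′ v ≡ k)
    forest′ k C with w ∈? CycleIn.verts C
    ... | yes w∈ = not-through-w k C w∈
    ... | no w∉  = forest k (CycleIn-All C (All.tabulate (avoiding-w k C w∉)))

  ColouredNeighbours : List (Fin n) → Fin n → (Fin n → Set) → List (Fin n) → Set
  ColouredNeighbours ws w Q xs = Unique xs × All (λ x → Adj w x × x ∉ ws × Q x) xs

  UncolouredNeighbours : List (Fin n) → Fin n → List (Fin n) → Set
  UncolouredNeighbours ws w ys = Unique ys × All (λ y → Adj w y × y ∈ ws) ys

  ColouredNeighbours-++ : ∀ {ws w P Q xs ys} → ColouredNeighbours ws w P xs → ColouredNeighbours ws w Q ys →
    (∀ {v} → P v → Q v → ⊥) → ColouredNeighbours ws w (λ v → P v ⊎ Q v) (xs ++ ys)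
  ColouredNeighbours-++ (uxs , pxs) (uys , qys) P∩Q =
    Unique.++⁺ uxs uys (λ (v∈xs , v∈ys) → P∩Q (proj₂ (proj₂ (All.lookup pxs v∈xs))) (proj₂ (proj₂ (All.lookup qys v∈ys)))) ,
    All.++⁺ (All.map (λ (a , b , p) → a , b , inj₁ p) pxs) (All.map (λ (a , b , q) → a , b , inj₂ q) qys)

  neighbours-++ : ∀ {ws w Q ys xs} → UncolouredNeighbours ws w ys → ColouredNeighbours ws w Q xs →
                  Unique (ys ++ xs) × All (Adj w) (ys ++ xs)
  neighbours-++ (uys , ays) (uxs , axs) =
    Unique.++⁺ uys uxs (λ (v∈ys , v∈xs) → proj₁ (proj₂ (All.lookup axs v∈xs)) (proj₂ (All.lookup ays v∈ys))) ,
    All.++⁺ (All.map proj₁ ays) (All.map proj₁ axs)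

  Blocked : List (Fin n) → (Fin n → ℕ) → Fin n → ℕ → Set
  Blocked ws h w c = ∃₂ λ x y → ColouredNeighbours ws w (λ v → h v ≡ c) (x ∷ y ∷ [])

  Blocked? : ∀ ws h w c → Dec (Blocked ws h w c)
  Blocked? ws h w c = any? λ x → any? λ y → unique? (x ∷ y ∷ []) ×-dec
    All.all? (λ v → (adj w v Bool.≟ true) ×-dec ¬? (v ∈? ws) ×-dec (h v ℕ.≟ c)) (x ∷ y ∷ [])

  ¬Blocked⇒Usable : ∀ {ws h w c} → ¬ Blocked ws h w c → Usable ws h w c
  ¬Blocked⇒Usable ¬b {x} {y} w~x w~y x∉ y∉ hx hy with x ≟ y
  ... | yes x≡y = x≡y
  ... | no x≢y = ⊥-elim (¬b (x , y , (x≢y ∷ []) ∷ [] ∷ [] , (w~x , x∉ , hx) ∷ (w~y , y∉ , hy) ∷ []))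

  colours-≢ : ∀ {w i j} → i ≢ j → colours w i ≢ colours w j
  colours-≢ {w} i≢j ci≡cj = i≢j (distinct w ci≡cj)

  distinct-colours : ∀ {w i j a} → i ≢ j → a ≡ colours w i → a ≢ colours w j
  distinct-colours i≢j a≡ci a≡cj = colours-≢ i≢j (trans (sym a≡ci) a≡cj)

  blockers : ∀ {ws h w c} → Blocked ws h w c → List (Fin n)
  blockers (x , y , _) = x ∷ y ∷ []

  Blocked-++ : ∀ {ws h w i j} → i ≢ j → (bi : Blocked ws h w (colours w i)) (bj : Blocked ws h w (colours w j)) →
    ColouredNeighbours ws w (λ v → h v ≡ colours w i ⊎ h v ≡ colours w j) (blockers bi ++ blockers bj)
  Blocked-++ i≢j (_ , _ , bi) (_ , _ , bj) = ColouredNeighbours-++ bi bj (distinct-colours i≢j)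

  usable-colour : ∀ {ws w ys} h → UncolouredNeighbours ws w ys → deg w ≤ length ys + 5 →
                  ∃ λ i → Usable ws h w (colours w i)
  usable-colour {ws} {w} {ys} h nbrs d
    with Blocked? ws h w (colours w zero) | Blocked? ws h w (colours w (suc zero))
       | Blocked? ws h w (colours w (suc (suc zero)))
  ... | no ¬b | _     | _     = zero , ¬Blocked⇒Usable ¬b
  ... | yes _ | no ¬b | _     = suc zero , ¬Blocked⇒Usable ¬b
  ... | yes _ | yes _ | no ¬b = suc (suc zero) , ¬Blocked⇒Usable ¬b
  ... | yes (_ , _ , b₀) | yes b₁@(_ , _ , _) | yes b₂@(_ , _ , _) =
    ⊥-elim (n≮n 5 (+-cancelˡ-≤ (length ys) 6 5 (≤-trans six-more d)))
    where
    c₀-not-c₁-c₂ : ∀ {v} → h v ≡ colours w zero → h v ≡ colours w (suc zero) ⊎ h v ≡ colours w (suc (suc zero)) → ⊥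
    c₀-not-c₁-c₂ h≡c₀ (inj₁ h≡c₁) = distinct-colours (λ ()) h≡c₀ h≡c₁
    c₀-not-c₁-c₂ h≡c₀ (inj₂ h≡c₂) = distinct-colours (λ ()) h≡c₀ h≡c₂
    six-more : length ys + 6 ≤ deg w
    six-more with neighbours-++ nbrs (ColouredNeighbours-++ b₀ (Blocked-++ (λ ()) b₁ b₂) c₀-not-c₁-c₂)
    ... | u , a = subst (_≤ deg w) (length-++ ys) (length≤deg u a)

  record Tight (ws : List (Fin n)) (h : Fin n → ℕ) (w : Fin n) (ys : List (Fin n)) : Set where
    field
      i j k     : Fin 3
      i≢j       : i ≢ j
      k≢i       : k ≢ i
      k≢j       : k ≢ j
      blocked-i : Blocked ws h w (colours w i)
      blocked-j : Blocked ws h w (colours w j)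
      covered   : ∀ {z} → Adj w z → z ∈ ys ⊎ (z ∉ ws × (h z ≡ colours w i ⊎ h z ≡ colours w j))

    free : ∀ {z} → Adj w z → h z ≡ colours w k → z ∈ ys
    free w~z hz≡ck with covered w~z
    ... | inj₁ z∈ys            = z∈ys
    ... | inj₂ (_ , inj₁ hz≡ci) = ⊥-elim (distinct-colours k≢i hz≡ck hz≡ci)
    ... | inj₂ (_ , inj₂ hz≡cj) = ⊥-elim (distinct-colours k≢j hz≡ck hz≡cj)

    uncoloured : ∀ {z} → Adj w z → z ∈ ws → z ∈ ys
    uncoloured w~z z∈ws with covered w~z
    ... | inj₁ z∈ys     = z∈ys
    ... | inj₂ (z∉ , _) = ⊥-elim (z∉ z∈ws)

  tight : ∀ {ws h w ys} i j k → UncolouredNeighbours ws w ys → deg w ≤ length ys + 4 →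
          i ≢ j → k ≢ i → k ≢ j → Blocked ws h w (colours w i) → Blocked ws h w (colours w j) → Tight ws h w ys
  tight {ws} {h} {w} {ys} i j k nbrs d i≢j k≢i k≢j bi@(_ , _ , _) bj@(_ , _ , _) = record
    { i≢j = i≢j ; k≢i = k≢i ; k≢j = k≢j ; blocked-i = bi ; blocked-j = bj ; covered = covered }
    where
    covered : ∀ {z} → Adj w z → z ∈ ys ⊎ (z ∉ ws × (h z ≡ colours w i ⊎ h z ≡ colours w j))
    covered w~z with neighbours-++ nbrs (Blocked-++ i≢j bi bj)
    ... | u , a with ∈-++⁻ ys (deg≤length⇒∈ u a (subst (deg w ≤_) (sym (length-++ ys)) d) w~z)
    ...   | inj₁ z∈ys = inj₁ z∈ys
    ...   | inj₂ z∈bs = inj₂ (proj₂ (All.lookup (proj₂ (Blocked-++ i≢j bi bj)) z∈bs))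

  usable-pair-or-tight : ∀ {ws w ys} h → UncolouredNeighbours ws w ys → deg w ≤ length ys + 4 →
    (∃₂ λ i j → i ≢ j × Usable ws h w (colours w i) × Usable ws h w (colours w j)) ⊎ Tight ws h w ys
  usable-pair-or-tight {ws} {w} h nbrs d
    with Blocked? ws h w (colours w zero) | Blocked? ws h w (colours w (suc zero))
       | Blocked? ws h w (colours w (suc (suc zero)))
  ... | no ¬b₀ | no ¬b₁ | _      = inj₁ (_ , _ , (λ ()) , ¬Blocked⇒Usable ¬b₀ , ¬Blocked⇒Usable ¬b₁)
  ... | no ¬b₀ | yes _  | no ¬b₂ = inj₁ (_ , _ , (λ ()) , ¬Blocked⇒Usable ¬b₀ , ¬Blocked⇒Usable ¬b₂)
  ... | no _   | yes b₁ | yes b₂ = inj₂ (tight _ _ zero nbrs d (λ ()) (λ ()) (λ ()) b₁ b₂)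
  ... | yes _  | no ¬b₁ | no ¬b₂ = inj₁ (_ , _ , (λ ()) , ¬Blocked⇒Usable ¬b₁ , ¬Blocked⇒Usable ¬b₂)
  ... | yes b₀ | no _   | yes b₂ = inj₂ (tight _ _ (suc zero) nbrs d (λ ()) (λ ()) (λ ()) b₀ b₂)
  ... | yes b₀ | yes b₁ | _      = inj₂ (tight _ _ (suc (suc zero)) nbrs d (λ ()) (λ ()) (λ ()) b₀ b₁)

  record Extension (S : Fin n → Set) (h : Fin n → ℕ) : Set where
    field
      colouring : Fin n → ℕ
      arboreal  : ArborealColouring G L colouring
      agrees    : Extends G S h colouring

  Extension-mono : ∀ {S S′ h} → (∀ {v} → S v → S′ v) → Extension S h → Extension S′ h
  Extension-mono S⊆S′ e = record { Extension e ; agrees = λ v v∉S′ → Extension.agrees e v (v∉S′ ∘ S⊆S′) }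

  extend-recolour : ∀ {w ws h c} → Extension (_∈ ws) (h [ w ]≔ c) → Extension (_∈ w ∷ ws) h
  extend-recolour e = record { Extension e ; agrees = λ v v∉ →
    trans (Extension.agrees e v (v∉ ∘ there)) (≔-minimal (v∉ ∘ here)) }

  recoloured : ∀ {w ws h c} → w ∉ ws → (e : Extension (_∈ ws) (h [ w ]≔ c)) → Extension.colouring e w ≡ c
  recoloured w∉ e = trans (Extension.agrees e _ w∉) ≔-updates

  data FiveDegenerate : List (Fin n) → Set where
    []  : FiveDegenerate []
    _∷_ : ∀ {w ws} → (∃ λ ys → UncolouredNeighbours ws w ys × deg w ≤ length ys + 5) →
          FiveDegenerate ws → FiveDegenerate (w ∷ ws)

  greedy : ∀ {ws h} → FiveDegenerate ws → ArborealMinus ws h → Extension (_∈ ws) h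
  greedy [] A = record { colouring = _ ; arboreal = ArborealColouringMinus-mono (λ ()) A ; agrees = λ _ _ → refl }
  greedy {h = h} ((_ , nbrs , d) ∷ order) A with usable-colour h nbrs d
  ... | i , ok = extend-recolour (greedy order (colour A i ok))

module DegreeFourVertex {n : ℕ} (G : Triangulation n) (L : ListAssignment3 G) where
  open Triangulation G

  module _
    {u u₁ u₂ u₃ u₄ : Fin n} (deg-u : deg u ≡ 4)
    (u~u₁ : Adj u u₁) (u~u₂ : Adj u u₂) (u~u₃ : Adj u u₃) (u~u₄ : Adj u u₄)
    (u₁~u₂ : Adj u₁ u₂) (u₂~u₃ : Adj u₂ u₃) (u₃~u₄ : Adj u₃ u₄) (u₄~u₁ : Adj u₄ u₁)
    (u₁≢u₂ : u₁ ≢ u₂) (u₁≢u₃ : u₁ ≢ u₃) (u₁≢u₄ : u₁ ≢ u₄) (u₂≢u₃ : u₂ ≢ u₃) (u₂≢u₄ : u₂ ≢ u₄) (u₃≢u₄ : u₃ ≢ u₄)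
    (deg-u₁ : deg u₁ ≤ 6) (deg-u₂ : deg u₂ ≤ 7) (deg-u₃ : deg u₃ ≤ 6)
    {col : Fin n → ℕ}
    (arb : ArborealColouringMinus G L (λ v → v ≡ u ⊎ v ≡ u₁ ⊎ v ≡ u₂ ⊎ v ≡ u₃) col)
    where

    open ListAssignment3 L
    open ArborealExtension G L
    open Extension

    Deleted : Fin n → Set
    Deleted v = v ≡ u ⊎ v ≡ u₁ ⊎ v ≡ u₂ ⊎ v ≡ u₃

    u≢u₁ : u ≢ u₁
    u≢u₁ = Adj⇒≢ u~u₁
    u≢u₂ : u ≢ u₂
    u≢u₂ = Adj⇒≢ u~u₂
    u≢u₃ : u ≢ u₃
    u≢u₃ = Adj⇒≢ u~u₃
    u≢u₄ : u ≢ u₄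
    u≢u₄ = Adj⇒≢ u~u₄

    neighbours-of-u : ∀ {z} → Adj u z → z ∈ u₁ ∷ u₂ ∷ u₃ ∷ u₄ ∷ []
    neighbours-of-u = deg≤length⇒∈
      ((u₁≢u₂ ∷ u₁≢u₃ ∷ u₁≢u₄ ∷ []) ∷ (u₂≢u₃ ∷ u₂≢u₄ ∷ []) ∷ (u₃≢u₄ ∷ []) ∷ [] ∷ [])
      (u~u₁ ∷ u~u₂ ∷ u~u₃ ∷ u~u₄ ∷ []) (≤-reflexive deg-u)

    start : ∀ {ws} → All (_∈ ws) (u ∷ u₁ ∷ u₂ ∷ u₃ ∷ []) → ArborealMinus ws col
    start (p ∷ p₁ ∷ p₂ ∷ p₃ ∷ []) = ArborealColouringMinus-mono
      (λ { (inj₁ refl) → p ; (inj₂ (inj₁ refl)) → p₁ ; (inj₂ (inj₂ (inj₁ refl))) → p₂ ; (inj₂ (inj₂ (inj₂ refl))) → p₃ })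
      arb

    ExtensionWith : Fin n → ℕ → Set
    ExtensionWith v c = Σ (Extension Deleted col) λ e → colouring e v ≡ c

    finish : ∀ {ws w c} → All Deleted ws → (e : Extension (_∈ ws) col) → colouring e w ≡ c → ExtensionWith w c
    finish ds e e-w = Extension-mono (All.lookup ds) e , e-w

    TwoExtensions : Set
    TwoExtensions = Σ (Extension Deleted col) λ e₁ → Σ (Extension Deleted col) λ e₂ → ∃ λ v → colouring e₁ v ≢ colouring e₂ v

    two-extensions : ∀ {v c c′} → ExtensionWith v c → ExtensionWith v c′ → c ≢ c′ → TwoExtensions
    two-extensions (e₁ , e₁-v) (e₂ , e₂-v) c≢c′ = e₁ , e₂ , _ , λ e → c≢c′ (trans (sym e₁-v) (trans e e₂-v))

    greedy-tail : ∀ {y} → Adj u₂ y → Adj y u → y ≢ u → deg y ≤ 6 → FiveDegenerate (u₂ ∷ y ∷ u ∷ [])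
    greedy-tail u₂~y y~u y≢u deg-y =
      (_ , ((y≢u ∷ []) ∷ [] ∷ [] , (u₂~y , here refl) ∷ (Adj-sym u~u₂ , there (here refl)) ∷ []) , deg-u₂) ∷
      (_ , ([] ∷ [] , (y~u , here refl) ∷ []) , deg-y) ∷
      (_ , ([] , []) , ≤-trans (≤-reflexive deg-u) (n≤1+n 4)) ∷ []

    -- Colour x, then u₂, y, u greedily, where {x, y} = {u₁, u₃}.
    side-first : ∀ {x y} → All (_∈ x ∷ u₂ ∷ y ∷ u ∷ []) (u ∷ u₁ ∷ u₂ ∷ u₃ ∷ []) → All Deleted (x ∷ u₂ ∷ y ∷ u ∷ []) →
      x ∉ u₂ ∷ y ∷ u ∷ [] → Adj u₂ y → Adj y u → y ≢ u → deg y ≤ 6 →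
      ∀ i → Usable (u₂ ∷ y ∷ u ∷ []) col x (colours x i) → ExtensionWith x (colours x i)
    side-first {x} {y} listed deleted x∉ u₂~y y~u y≢u deg-y i ok =
      finish deleted (extend-recolour e) (recoloured x∉ e)
      where
      e : Extension (_∈ u₂ ∷ y ∷ u ∷ []) (col [ x ]≔ colours x i)
      e = greedy (greedy-tail u₂~y y~u y≢u deg-y) (colour (start listed) i ok)

    u₁-first : ∀ i → Usable (u₂ ∷ u₃ ∷ u ∷ []) col u₁ (colours u₁ i) → ExtensionWith u₁ (colours u₁ i)
    u₁-first = side-first
      (there (there (there (here refl))) ∷ here refl ∷ there (here refl) ∷ there (there (here refl)) ∷ [])
      (inj₂ (inj₁ refl) ∷ inj₂ (inj₂ (inj₁ refl)) ∷ inj₂ (inj₂ (inj₂ refl)) ∷ inj₁ refl ∷ [])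
      (All¬⇒¬Any (u₁≢u₂ ∷ u₁≢u₃ ∷ ≢-sym u≢u₁ ∷ [])) u₂~u₃ (Adj-sym u~u₃) (≢-sym u≢u₃) deg-u₃

    u₃-first : ∀ i → Usable (u₂ ∷ u₁ ∷ u ∷ []) col u₃ (colours u₃ i) → ExtensionWith u₃ (colours u₃ i)
    u₃-first = side-first
      (there (there (there (here refl))) ∷ there (there (here refl)) ∷ there (here refl) ∷ here refl ∷ [])
      (inj₂ (inj₂ (inj₂ refl)) ∷ inj₂ (inj₂ (inj₁ refl)) ∷ inj₂ (inj₁ refl) ∷ inj₁ refl ∷ [])
      (All¬⇒¬Any (≢-sym u₂≢u₃ ∷ ≢-sym u₁≢u₃ ∷ ≢-sym u≢u₃ ∷ [])) (Adj-sym u₁~u₂) (Adj-sym u~u₁) (≢-sym u≢u₁) deg-u₁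

    module BothTight (T₁ : Tight (u₂ ∷ u₃ ∷ u ∷ []) col u₁ (u ∷ u₂ ∷ []))
                     (T₃ : Tight (u₂ ∷ u₁ ∷ u ∷ []) col u₃ (u ∷ u₂ ∷ [])) where

      r₁ r₃ : ℕ
      r₁ = colours u₁ (Tight.k T₁)
      r₃ = colours u₃ (Tight.k T₃)

      u₁≁u₃ : ¬ Adj u₁ u₃
      u₁≁u₃ u₁~u₃ with Tight.uncoloured T₁ u₁~u₃ (there (here refl))
      ... | here u₃≡u          = u≢u₃ (sym u₃≡u)
      ... | there (here u₃≡u₂) = u₂≢u₃ (sym u₃≡u₂)

      col-u₄≢r₁ : col u₄ ≢ r₁
      col-u₄≢r₁ e with Tight.free T₁ (Adj-sym u₄~u₁) e
      ... | here u₄≡u          = u≢u₄ (sym u₄≡u)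
      ... | there (here u₄≡u₂) = u₂≢u₄ (sym u₄≡u₂)

      col-u₄≢r₃ : col u₄ ≢ r₃
      col-u₄≢r₃ e with Tight.free T₃ u₃~u₄ e
      ... | here u₄≡u          = u≢u₄ (sym u₄≡u)
      ... | there (here u₄≡u₂) = u₂≢u₄ (sym u₄≡u₂)

      r₃-usable : ∀ {ws h} → u ∈ ws → (∀ {v} → v ≢ u₁ → v ≢ u₂ → h v ≡ col v) → Usable ws h u₃ r₃
      r₃-usable {h = h} u∈ws h≗col = Usable-if-only u₂ only-u₂
        where
        only-u₂ : ∀ {z} → Adj u₃ z → z ∉ _ → h z ≡ r₃ → z ≡ u₂
        only-u₂ {z} u₃~z z∉ hz with z ≟ u₂
        ... | yes z≡u₂ = z≡u₂
        ... | no z≢u₂ with Tight.free T₃ u₃~z (trans (sym (h≗col (λ { refl → u₁≁u₃ (Adj-sym u₃~z) }) z≢u₂)) hz)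
        ...   | here refl       = ⊥-elim (z∉ u∈ws)
        ...   | there (here z≡u₂) = ⊥-elim (z≢u₂ z≡u₂)

      h₁ : Fin n → ℕ
      h₁ = col [ u₁ ]≔ r₁

      A₁ : ArborealMinus (u₂ ∷ u₃ ∷ u ∷ []) h₁
      A₁ = colour (start (there (there (there (here refl))) ∷ here refl ∷ there (here refl) ∷ there (there (here refl)) ∷ []))
                  (Tight.k T₁)
                  (Usable-if-uncoloured λ u₁~z e → uncoloured (Tight.free T₁ u₁~z e))
        where
        uncoloured : ∀ {z} → z ∈ u ∷ u₂ ∷ [] → z ∈ u₂ ∷ u₃ ∷ u ∷ []
        uncoloured (here z≡u) = there (there (here z≡u))
        uncoloured (there (here z≡u₂)) = here z≡u₂

      f₂-usable : ∃ λ i → Usable (u₃ ∷ u ∷ []) h₁ u₂ (colours u₂ i)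
      f₂-usable = usable-colour h₁
        ((≢-sym u≢u₃ ∷ []) ∷ [] ∷ [] , (u₂~u₃ , here refl) ∷ (Adj-sym u~u₂ , there (here refl)) ∷ []) deg-u₂

      i₂ : Fin 3
      i₂ = proj₁ f₂-usable

      f₂ : ℕ
      f₂ = colours u₂ i₂

      h₂ h₃ : Fin n → ℕ
      h₂ = h₁ [ u₂ ]≔ f₂
      h₃ = h₂ [ u₃ ]≔ r₃

      A₃ : ArborealMinus [ u ] h₃
      A₃ = colour (colour A₁ i₂ (proj₂ f₂-usable)) (Tight.k T₃)
                  (r₃-usable (here refl) λ v≢u₁ v≢u₂ → trans (≔-minimal v≢u₂) (≔-minimal v≢u₁))

      h₃-u₁ : h₃ u₁ ≡ r₁
      h₃-u₁ = trans (≔-minimal u₁≢u₃) (trans (≔-minimal u₁≢u₂) ≔-updates)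
      h₃-u₂ : h₃ u₂ ≡ f₂
      h₃-u₂ = trans (≔-minimal u₂≢u₃) ≔-updates
      h₃-u₃ : h₃ u₃ ≡ r₃
      h₃-u₃ = ≔-updates
      h₃-u₄ : h₃ u₄ ≡ col u₄
      h₃-u₄ = trans (≔-minimal (≢-sym u₃≢u₄)) (trans (≔-minimal (≢-sym u₂≢u₄)) (≔-minimal (≢-sym u₁≢u₄)))

      colour-u-last : ∀ i → Usable [] h₃ u (colours u i) → ExtensionWith u (colours u i)
      colour-u-last i ok =
        finish (inj₂ (inj₁ refl) ∷ inj₂ (inj₂ (inj₁ refl)) ∷ inj₂ (inj₂ (inj₂ refl)) ∷ inj₁ refl ∷ [])
          (extend-recolour (extend-recolour (extend-recolour (extend-recolour e)))) (recoloured (λ ()) e)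
        where
        e : Extension (_∈ []) (h₃ [ u ]≔ colours u i)
        e = greedy [] (colour A₃ i ok)

      module TightAtU (T : Tight [] h₃ u []) where
        open Tight T

        on-two-colours : ∀ {z c} → Adj u z → h₃ z ≡ c → c ≡ colours u i ⊎ c ≡ colours u j
        on-two-colours u~z hz with covered u~z
        ... | inj₂ (_ , inj₁ e) = inj₁ (trans (sym hz) e)
        ... | inj₂ (_ , inj₂ e) = inj₂ (trans (sym hz) e)

        r₁≡r₃ : r₁ ≡ r₃
        r₁≡r₃ = ≡-of-two-values (on-two-colours u~u₁ h₃-u₁) (on-two-colours u~u₃ h₃-u₃)
                                (on-two-colours u~u₄ h₃-u₄) col-u₄≢r₁ col-u₄≢r₃

        r₁∈L[u] : ∃ λ m → colours u m ≡ r₁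
        r₁∈L[u] with on-two-colours u~u₁ h₃-u₁
        ... | inj₁ e = i , sym e
        ... | inj₂ e = j , sym e

        -- If f₂ were r₁, only u₄ could carry any other colour, so that colour could not be blocked.
        blocked⇒f₂≢r₁ : ∀ {c} → c ≢ r₁ → Blocked [] h₃ u c → f₂ ≢ r₁
        blocked⇒f₂≢r₁ {c} c≢r₁ (_ , _ , (x≢y ∷ []) ∷ _ , (u~x , _ , hx) ∷ (u~y , _ , hy) ∷ []) f₂≡r₁ =
          x≢y (trans (is-u₄ u~x hx) (sym (is-u₄ u~y hy)))
          where
          is-u₄ : ∀ {z} → Adj u z → h₃ z ≡ c → z ≡ u₄
          is-u₄ u~z hz with neighbours-of-u u~z
          ... | here refl                     = ⊥-elim (c≢r₁ (trans (sym hz) h₃-u₁))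
          ... | there (here refl)             = ⊥-elim (c≢r₁ (trans (sym hz) (trans h₃-u₂ f₂≡r₁)))
          ... | there (there (here refl))     = ⊥-elim (c≢r₁ (trans (sym hz) (trans h₃-u₃ (sym r₁≡r₃))))
          ... | there (there (there (here e))) = e

        f₂≢r₁ : f₂ ≢ r₁
        f₂≢r₁ with colours u i ℕ.≟ r₁
        ... | yes ci≡r₁ = blocked⇒f₂≢r₁ (λ cj≡r₁ → colours-≢ i≢j (trans ci≡r₁ (sym cj≡r₁))) blocked-j
        ... | no ci≢r₁  = blocked⇒f₂≢r₁ ci≢r₁ blocked-i

        m : Fin 3
        m = proj₁ r₁∈L[u]

        g₁ g₂ g₃ g₄ : Fin n → ℕ
        g₁ = col [ u₂ ]≔ f₂
        g₂ = g₁ [ u₃ ]≔ r₃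
        g₃ = g₂ [ u ]≔ colours u m
        g₄ = g₃ [ u₁ ]≔ r₁

        g₃-u₂ : g₃ u₂ ≡ f₂
        g₃-u₂ = trans (≔-minimal (≢-sym u≢u₂)) (trans (≔-minimal u₂≢u₃) ≔-updates)

        g₂-u₄ : g₂ u₄ ≡ col u₄
        g₂-u₄ = trans (≔-minimal (≢-sym u₃≢u₄)) (≔-minimal (≢-sym u₂≢u₄))

        g₂-only-u₃ : ∀ {z} → Adj u z → z ∉ [ u₁ ] → g₂ z ≡ colours u m → z ≡ u₃
        g₂-only-u₃ u~z z∉ gz with neighbours-of-u u~z
        ... | here refl = ⊥-elim (z∉ (here refl))
        ... | there (here refl) =
          ⊥-elim (f₂≢r₁ (trans (sym (trans (≔-minimal u₂≢u₃) ≔-updates)) (trans gz (proj₂ r₁∈L[u]))))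
        ... | there (there (here refl)) = refl
        ... | there (there (there (here refl))) = ⊥-elim (col-u₄≢r₁ (trans (sym g₂-u₄) (trans gz (proj₂ r₁∈L[u]))))

        g₃-only-u : ∀ {z} → Adj u₁ z → z ∉ [] → g₃ z ≡ r₁ → z ≡ u
        g₃-only-u {z} u₁~z _ gz with z ≟ u | z ≟ u₂
        ... | yes z≡u | _        = z≡u
        ... | no z≢u  | yes refl = ⊥-elim (f₂≢r₁ (trans (sym g₃-u₂) gz))
        ... | no z≢u  | no z≢u₂ with Tight.free T₁ u₁~z
              (trans (sym (trans (≔-minimal z≢u) (trans (≔-minimal λ { refl → u₁≁u₃ u₁~z }) (≔-minimal z≢u₂)))) gz)
        ...   | here z≡u          = ⊥-elim (z≢u z≡u)
        ...   | there (here z≡u₂) = ⊥-elim (z≢u₂ z≡u₂)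

        B₁ : ArborealMinus (u₃ ∷ u ∷ u₁ ∷ []) g₁
        B₁ = colour (start (there (there (here refl)) ∷ there (there (there (here refl))) ∷ here refl ∷ there (here refl) ∷ []))
                    i₂ (Usable-mono (λ { (here e) → here e ; (there (here e)) → there (here e) })
                                    (λ v∉ → sym (≔-minimal (v∉ ∘ there ∘ there ∘ here)))
                                    (proj₂ f₂-usable))

        B₄ : ArborealMinus [] g₄
        B₄ = colour (colour (colour B₁ (Tight.k T₃) (r₃-usable (here refl) λ _ v≢u₂ → ≔-minimal v≢u₂))
                            m (Usable-if-only u₃ g₂-only-u₃))
                    (Tight.k T₁) (Usable-if-only u g₃-only-u)

        -- Recolouring in the order u₂, u₃, u, u₁ lets u take the colour r₁ that u₁ and u₃ share.
        u-coloured-r₁ : ExtensionWith u r₁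
        u-coloured-r₁ =
          finish (inj₂ (inj₂ (inj₁ refl)) ∷ inj₂ (inj₂ (inj₂ refl)) ∷ inj₁ refl ∷ inj₂ (inj₁ refl) ∷ [])
            (extend-recolour (extend-recolour (extend-recolour (extend-recolour (greedy [] B₄)))))
            (trans (≔-minimal u≢u₁) (trans ≔-updates (proj₂ r₁∈L[u])))

        result : TwoExtensions
        result with usable-colour h₃ ([] , []) (≤-trans (≤-reflexive deg-u) (n≤1+n 4))
        ... | c , ok = two-extensions (colour-u-last c ok) u-coloured-r₁ c≢r₁
          where
          c≢r₁ : colours u c ≢ r₁
          c≢r₁ c≡r₁ = u₁≢u₃ (ok u~u₁ u~u₃ (λ ()) (λ ()) (trans h₃-u₁ (sym c≡r₁)) (trans h₃-u₃ (trans (sym r₁≡r₃) (sym c≡r₁))))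

      result : TwoExtensions
      result with usable-pair-or-tight h₃ ([] , []) (≤-reflexive deg-u)
      ... | inj₁ (i , j , i≢j , oki , okj) = two-extensions (colour-u-last i oki) (colour-u-last j okj) (colours-≢ i≢j)
      ... | inj₂ T = TightAtU.result T

    two-extensions-exist : TwoExtensions
    two-extensions-exist
      with usable-pair-or-tight col
             ((u≢u₂ ∷ []) ∷ [] ∷ [] , (Adj-sym u~u₁ , there (there (here refl))) ∷ (u₁~u₂ , here refl) ∷ []) deg-u₁
    ... | inj₁ (i , j , i≢j , oki , okj) = two-extensions (u₁-first i oki) (u₁-first j okj) (colours-≢ i≢j)
    ... | inj₂ T₁
      with usable-pair-or-tight col
             ((u≢u₂ ∷ []) ∷ [] ∷ [] , (Adj-sym u~u₃ , there (there (here refl))) ∷ (Adj-sym u₂~u₃ , here refl) ∷ []) deg-u₃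
    ...   | inj₁ (i , j , i≢j , oki , okj) = two-extensions (u₃-first i oki) (u₃-first j okj) (colours-≢ i≢j)
    ...   | inj₂ T₃ = BothTight.result T₁ T₃

mainTheorem5 : ∀ {n} (G : Triangulation n) (L : ListAssignment3 G)
    (u u₁ u₂ u₃ u₄ : Fin n) →
    Triangulation.deg G u ≡ 4 →
    Triangulation.Adj G u u₁ → Triangulation.Adj G u u₂ →
    Triangulation.Adj G u u₃ → Triangulation.Adj G u u₄ →
    u₁ ≢ u₂ → u₁ ≢ u₃ → u₁ ≢ u₄ → u₂ ≢ u₃ → u₂ ≢ u₄ → u₃ ≢ u₄ →
    Triangulation.HasFace G u u₁ u₂ → Triangulation.HasFace G u u₂ u₃ →
    Triangulation.HasFace G u u₃ u₄ → Triangulation.HasFace G u u₄ u₁ →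
    Triangulation.deg G u₁ ≤ 6 → Triangulation.deg G u₂ ≤ 7 →
    Triangulation.deg G u₃ ≤ 6 →
    (col : Fin n → ℕ) →
    ArborealColouringMinus G L (λ v → v ≡ u ⊎ v ≡ u₁ ⊎ v ≡ u₂ ⊎ v ≡ u₃) col →
    Σ (Fin n → ℕ) λ col₁ → Σ (Fin n → ℕ) λ col₂ →
      ArborealColouring G L col₁ × ArborealColouring G L col₂ ×
      Extends G (λ v → v ≡ u ⊎ v ≡ u₁ ⊎ v ≡ u₂ ⊎ v ≡ u₃) col col₁ ×
      Extends G (λ v → v ≡ u ⊎ v ≡ u₁ ⊎ v ≡ u₂ ⊎ v ≡ u₃) col col₂ ×
      Σ (Fin n) (λ v → col₁ v ≢ col₂ v)
mainTheorem5 G L u u₁ u₂ u₃ u₄ deg-u u~u₁ u~u₂ u~u₃ u~u₄ u₁≢u₂ u₁≢u₃ u₁≢u₄ u₂≢u₃ u₂≢u₄ u₃≢u₄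
             f₁₂ f₂₃ f₃₄ f₄₁ deg-u₁ deg-u₂ deg-u₃ col arb
  with DegreeFourVertex.two-extensions-exist G L deg-u u~u₁ u~u₂ u~u₃ u~u₄
         (HasFace⇒Adj u f₁₂ u₁≢u₂) (HasFace⇒Adj u f₂₃ u₂≢u₃) (HasFace⇒Adj u f₃₄ u₃≢u₄) (HasFace⇒Adj u f₄₁ (≢-sym u₁≢u₄))
         u₁≢u₂ u₁≢u₃ u₁≢u₄ u₂≢u₃ u₂≢u₄ u₃≢u₄ deg-u₁ deg-u₂ deg-u₃ arb
  where open ArborealExtension G L
... | e₁ , e₂ , v , differ = colouring e₁ , colouring e₂ , arboreal e₁ , arboreal e₂ , agrees e₁ , agrees e₂ , v , differ
  where open ArborealExtension.Extension
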